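{- Let $L$ be an $n\times n$ M-matrix with integer entries. For every configuration $f\in\mathbb{Z}^n$ with $f\ge 0$, the minimization problem \[ \min\{\,E(g) : g\in\mathbb{Z}^n,\ g\sim f,\ g\ge 0\,\},\qquad E(g)=\|L^{ -1}g\|_2^2, \] has a unique solution. That is, there is exactly one energy minimizer equivalent to $f$.
   Context: An $n\times n$ real matrix $L$ is a Z-matrix if $L_{ij}\le 0$ for all $i\neq j$. A (non-singular) M-matrix is a Z-matrix $L$ that is invertible with $L^{ -1}$ entrywise non-negative; equivalently, all eigenvalues of $L$ have positive real part, or there is $x\ge 0$ with $Lx$ entrywise positive. A configuration is a vector in $\mathbb{Z}^n$. Two configurations $f,g$ are equivalent, written $f\sim g$, if $g-f=Lz$ for some $z\in\mathbb{Z}^n$. Vector inequalities such as $g\ge 0$ are entrywise, and $\|v\|_2^2=v\cdot v$. An energy minimizer equivalent to $f$ is a solution of the displayed minimization problem. -}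

module Defs where

open import Data.Nat using (ℕ; zero; suc)
open import Data.Fin using (Fin; zero; suc)
open import Data.Integer as ℤ using (ℤ; +_)
open import Data.Rational as ℚ using (ℚ; 0ℚ; 1ℚ)
open import Data.Product using (Σ; _×_; ∃)
open import Relation.Binary.PropositionalEquality using (_≡_)
open import Relation.Nullary using (¬_)

Mat : Set → ℕ → Set
Mat A n = Fin n → Fin n → A

Vec : Set → ℕ → Set
Vec A n = Fin n → A

sumℤ : ∀ n → (Fin n → ℤ) → ℤ
sumℤ zero    f = + 0
sumℤ (suc n) f = f zero ℤ.+ sumℤ n (λ i → f (suc i))

sumℚ : ∀ n → (Fin n → ℚ) → ℚ
sumℚ zero    f = 0ℚ
sumℚ (suc n) f = f zero ℚ.+ sumℚ n (λ i → f (suc i))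

toℚ : ℤ → ℚ
toℚ z = z ℚ./ 1

mulℤ : ∀ {n} → Mat ℤ n → Vec ℤ n → Vec ℤ n
mulℤ {n} L z i = sumℤ n (λ j → L i j ℤ.* z j)

mulℚ : ∀ {n} → Mat ℚ n → Vec ℚ n → Vec ℚ n
mulℚ {n} A v i = sumℚ n (λ j → A i j ℚ.* v j)

δ : ∀ {n} → Fin n → Fin n → ℚ
δ zero    zero    = 1ℚ
δ zero    (suc j) = 0ℚ
δ (suc i) zero    = 0ℚ
δ (suc i) (suc j) = δ i j

IsZMatrix : ∀ {n} → Mat ℤ n → Set
IsZMatrix L = ∀ i j → ¬ (i ≡ j) → L i j ℤ.≤ + 0

IsInverse : ∀ {n} → Mat ℤ n → Mat ℚ n → Set
IsInverse {n} L Linv =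
  (∀ i k → sumℚ n (λ j → toℚ (L i j) ℚ.* Linv j k) ≡ δ i k) ×
  (∀ i k → sumℚ n (λ j → Linv i j ℚ.* toℚ (L j k)) ≡ δ i k)

NonnegMat : ∀ {n} → Mat ℚ n → Set
NonnegMat A = ∀ i j → 0ℚ ℚ.≤ A i j

-- (non-singular) M-matrix: Z-matrix, invertible, with entrywise non-negative inverse.
-- The inverse is made explicit as a witness (it is unique).
IsMMatrixWithInverse : ∀ {n} → Mat ℤ n → Mat ℚ n → Set
IsMMatrixWithInverse L Linv = IsZMatrix L × IsInverse L Linv × NonnegMat Linv

Nonneg : ∀ {n} → Vec ℤ n → Set
Nonneg f = ∀ i → + 0 ℤ.≤ f i

Equiv : ∀ {n} → Mat ℤ n → Vec ℤ n → Vec ℤ n → Set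
Equiv {n} L f g = ∃ λ (z : Vec ℤ n) → ∀ i → g i ℤ.- f i ≡ mulℤ L z i

energy : ∀ {n} → Mat ℚ n → Vec ℤ n → ℚ
energy {n} Linv g = sumℚ n (λ i → v i ℚ.* v i)
  where
  v : Vec ℚ n
  v = mulℚ Linv (λ j → toℚ (g j))

IsEnergyMinimizer : ∀ {n} → Mat ℤ n → Mat ℚ n → Vec ℤ n → Vec ℤ n → Set
IsEnergyMinimizer L Linv f g =
  Equiv L f g × Nonneg g ×
  (∀ h → Equiv L f h → Nonneg h → energy Linv g ℚ.≤ energy Linv h)

module Submission where

-- The configurations equivalent to f are the f + L z, and L⁻¹ (f + L z) = L⁻¹ f + z.
-- Call z feasible when f + L z ≥ 0. Because L is a Z-matrix, the feasible vectors have a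
-- least element z₀ (least action principle): start below every feasible vector, which is
-- possible since L⁻¹ ≥ 0 forces z ≥ -L⁻¹ f, and repeatedly raise the coordinate of a
-- violated row; such a row stays violated as long as that coordinate is unchanged, so no
-- feasible vector is ever overtaken. For g = f + L z₀ the vector L⁻¹ g = L⁻¹ f + z₀ is
-- non-negative and coordinatewise below L⁻¹ h for every other non-negative h ~ f, strictly
-- in some coordinate unless h = g; hence ‖L⁻¹ g‖² is the unique minimum.

open import Defs
open import Data.Nat as ℕ using (ℕ; zero; suc)
import Data.Nat.Properties as ℕP
open import Data.Fin using (Fin; zero; suc)
import Data.Fin.Properties as FP
open import Data.Integer as ℤ using (ℤ; +_; -[1+_])
import Data.Integer.Properties as ℤP
open import Data.Integer.Tactic.RingSolver using (solve-∀)
open import Data.Rational as ℚ using (ℚ; 0ℚ; 1ℚ; mkℚ)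
import Data.Rational.Properties as ℚP
import Data.Rational.Unnormalised as ℚᵘ
import Data.Rational.Unnormalised.Properties as ℚᵘP
open import Data.Vec.Functional using (updateAt)
open import Data.Vec.Functional.Properties using (updateAt-updates; updateAt-minimal)
open import Data.Product using (∃; _×_; _,_; proj₁; proj₂)
open import Function using (_∘_)
open import Relation.Binary.PropositionalEquality
open import Relation.Nullary using (yes; no)
open import Data.Empty using (⊥-elim)
open import Algebra.Bundles using (CommutativeMonoid)
open import Algebra.Properties.CommutativeSemigroup
  (CommutativeMonoid.commutativeSemigroup ℚP.+-0-commutativeMonoid) using (interchange)

toℚᵘ-toℚ : ∀ a → ℚ.toℚᵘ (toℚ a) ℚᵘ.≃ ℚᵘ.mkℚᵘ a 0
toℚᵘ-toℚ a = ℚP.toℚᵘ-fromℚᵘ (ℚᵘ.mkℚᵘ a 0)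

toℚ-+ : ∀ a b → toℚ (a ℤ.+ b) ≡ toℚ a ℚ.+ toℚ b
toℚ-+ a b = ℚP.toℚᵘ-injective (begin
  ℚ.toℚᵘ (toℚ (a ℤ.+ b))              ≈⟨ toℚᵘ-toℚ (a ℤ.+ b) ⟩
  ℚᵘ.mkℚᵘ (a ℤ.+ b) 0                 ≈⟨ ℚᵘ.*≡* (cong (ℤ._* + 1) (sym a*1+b*1≡a+b)) ⟩
  ℚᵘ.mkℚᵘ a 0 ℚᵘ.+ ℚᵘ.mkℚᵘ b 0        ≈⟨ ℚᵘP.+-cong (toℚᵘ-toℚ a) (toℚᵘ-toℚ b) ⟨
  ℚ.toℚᵘ (toℚ a) ℚᵘ.+ ℚ.toℚᵘ (toℚ b)  ≈⟨ ℚP.toℚᵘ-homo-+ (toℚ a) (toℚ b) ⟨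
  ℚ.toℚᵘ (toℚ a ℚ.+ toℚ b)            ∎)
  where
  open ℚᵘP.≃-Reasoning
  a*1+b*1≡a+b : a ℤ.* + 1 ℤ.+ b ℤ.* + 1 ≡ a ℤ.+ b
  a*1+b*1≡a+b = cong₂ ℤ._+_ (ℤP.*-identityʳ a) (ℤP.*-identityʳ b)

toℚ-* : ∀ a b → toℚ (a ℤ.* b) ≡ toℚ a ℚ.* toℚ b
toℚ-* a b = ℚP.toℚᵘ-injective (begin
  ℚ.toℚᵘ (toℚ (a ℤ.* b))              ≈⟨ toℚᵘ-toℚ (a ℤ.* b) ⟩
  ℚᵘ.mkℚᵘ (a ℤ.* b) 0                 ≡⟨⟩
  ℚᵘ.mkℚᵘ a 0 ℚᵘ.* ℚᵘ.mkℚᵘ b 0        ≈⟨ ℚᵘP.*-cong (toℚᵘ-toℚ a) (toℚᵘ-toℚ b) ⟨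
  ℚ.toℚᵘ (toℚ a) ℚᵘ.* ℚ.toℚᵘ (toℚ b)  ≈⟨ ℚP.toℚᵘ-homo-* (toℚ a) (toℚ b) ⟨
  ℚ.toℚᵘ (toℚ a ℚ.* toℚ b)            ∎)
  where open ℚᵘP.≃-Reasoning

toℚ-mono-≤ : ∀ {a b} → a ℤ.≤ b → toℚ a ℚ.≤ toℚ b
toℚ-mono-≤ {a} {b} a≤b = ℚP.toℚᵘ-cancel-≤ (begin
  ℚ.toℚᵘ (toℚ a)  ≃⟨ toℚᵘ-toℚ a ⟩
  ℚᵘ.mkℚᵘ a 0     ≤⟨ ℚᵘ.*≤* (ℤP.*-monoʳ-≤-nonNeg (+ 1) a≤b) ⟩
  ℚᵘ.mkℚᵘ b 0     ≃⟨ toℚᵘ-toℚ b ⟨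
  ℚ.toℚᵘ (toℚ b)  ∎)
  where open ℚᵘP.≤-Reasoning

toℚ-mono-< : ∀ {a b} → a ℤ.< b → toℚ a ℚ.< toℚ b
toℚ-mono-< {a} {b} a<b = ℚP.toℚᵘ-cancel-< (begin-strict
  ℚ.toℚᵘ (toℚ a)  ≃⟨ toℚᵘ-toℚ a ⟩
  ℚᵘ.mkℚᵘ a 0     <⟨ ℚᵘ.*<* (ℤP.*-monoʳ-<-pos (+ 1) a<b) ⟩
  ℚᵘ.mkℚᵘ b 0     ≃⟨ toℚᵘ-toℚ b ⟨
  ℚ.toℚᵘ (toℚ b)  ∎)
  where open ℚᵘP.≤-Reasoning

toℚ-cancel-≤ : ∀ {a b} → toℚ a ℚ.≤ toℚ b → a ℤ.≤ b
toℚ-cancel-≤ {a} {b} le = ℤP.*-cancelʳ-≤-pos a b (+ 1) (ℚᵘP.drop-*≤* (begin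
  ℚᵘ.mkℚᵘ a 0     ≃⟨ toℚᵘ-toℚ a ⟨
  ℚ.toℚᵘ (toℚ a)  ≤⟨ ℚP.toℚᵘ-mono-≤ le ⟩
  ℚ.toℚᵘ (toℚ b)  ≃⟨ toℚᵘ-toℚ b ⟩
  ℚᵘ.mkℚᵘ b 0     ∎))
  where open ℚᵘP.≤-Reasoning

integer-above : ∀ q → ∃ λ a → q ℚ.≤ toℚ a
integer-above (mkℚ (+ p) d _) = + p , ℚP.toℚᵘ-cancel-≤ (ℚᵘP.≤-respʳ-≃ (ℚᵘP.≃-sym (toℚᵘ-toℚ (+ p)))
  (ℚᵘ.*≤* (ℤP.*-monoˡ-≤-nonNeg (+ p) (ℤ.+≤+ (ℕ.s≤s ℕ.z≤n)))))
integer-above (mkℚ -[1+ p ] d _) = + 0 , ℚ.*≤* ℤ.-≤+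

sumℚ-cong : ∀ n {u v : Fin n → ℚ} → (∀ i → u i ≡ v i) → sumℚ n u ≡ sumℚ n v
sumℚ-cong zero    eq = refl
sumℚ-cong (suc n) eq = cong₂ ℚ._+_ (eq zero) (sumℚ-cong n (eq ∘ suc))

sumℚ-0 : ∀ n → sumℚ n (λ _ → 0ℚ) ≡ 0ℚ
sumℚ-0 zero    = refl
sumℚ-0 (suc n) = trans (ℚP.+-identityˡ _) (sumℚ-0 n)

sumℚ-+ : ∀ n (u v : Fin n → ℚ) → sumℚ n (λ i → u i ℚ.+ v i) ≡ sumℚ n u ℚ.+ sumℚ n v
sumℚ-+ zero    u v = refl
sumℚ-+ (suc n) u v = trans (cong (u zero ℚ.+ v zero ℚ.+_) (sumℚ-+ n (u ∘ suc) (v ∘ suc)))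
  (interchange (u zero) (v zero) _ _)

sumℚ-*ˡ : ∀ n c (u : Fin n → ℚ) → sumℚ n (λ i → c ℚ.* u i) ≡ c ℚ.* sumℚ n u
sumℚ-*ˡ zero    c u = sym (ℚP.*-zeroʳ c)
sumℚ-*ˡ (suc n) c u = trans (cong (c ℚ.* u zero ℚ.+_) (sumℚ-*ˡ n c (u ∘ suc)))
  (sym (ℚP.*-distribˡ-+ c (u zero) _))

sumℚ-*ʳ : ∀ n c (u : Fin n → ℚ) → sumℚ n (λ i → u i ℚ.* c) ≡ sumℚ n u ℚ.* c
sumℚ-*ʳ zero    c u = sym (ℚP.*-zeroˡ c)
sumℚ-*ʳ (suc n) c u = trans (cong (u zero ℚ.* c ℚ.+_) (sumℚ-*ʳ n c (u ∘ suc)))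
  (sym (ℚP.*-distribʳ-+ c (u zero) _))

sumℚ-comm : ∀ m n (F : Fin m → Fin n → ℚ) →
  sumℚ m (λ i → sumℚ n (F i)) ≡ sumℚ n (λ j → sumℚ m (λ i → F i j))
sumℚ-comm zero    n F = sym (sumℚ-0 n)
sumℚ-comm (suc m) n F = trans (cong (sumℚ n (F zero) ℚ.+_) (sumℚ-comm m n (F ∘ suc)))
  (sym (sumℚ-+ n (F zero) _))

sumℚ-mono-≤ : ∀ n {u v : Fin n → ℚ} → (∀ i → u i ℚ.≤ v i) → sumℚ n u ℚ.≤ sumℚ n v
sumℚ-mono-≤ zero    le = ℚP.≤-refl
sumℚ-mono-≤ (suc n) le = ℚP.+-mono-≤ (le zero) (sumℚ-mono-≤ n (le ∘ suc))

sumℚ-mono-< : ∀ n {u v : Fin n → ℚ} → (∀ i → u i ℚ.≤ v i) → ∀ k → u k ℚ.< v k →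
  sumℚ n u ℚ.< sumℚ n v
sumℚ-mono-< (suc n) le zero    lt = ℚP.+-mono-<-≤ lt (sumℚ-mono-≤ n (le ∘ suc))
sumℚ-mono-< (suc n) le (suc k) lt = ℚP.+-mono-≤-< (le zero) (sumℚ-mono-< n (le ∘ suc) k lt)

sumℤ-cong : ∀ n {u v : Fin n → ℤ} → (∀ i → u i ≡ v i) → sumℤ n u ≡ sumℤ n v
sumℤ-cong zero    eq = refl
sumℤ-cong (suc n) eq = cong₂ ℤ._+_ (eq zero) (sumℤ-cong n (eq ∘ suc))

sumℤ-0 : ∀ n → sumℤ n (λ _ → + 0) ≡ + 0
sumℤ-0 zero    = refl
sumℤ-0 (suc n) = trans (ℤP.+-identityˡ _) (sumℤ-0 n)

sumℤ-mono-≤ : ∀ n {u v : Fin n → ℤ} → (∀ i → u i ℤ.≤ v i) → sumℤ n u ℤ.≤ sumℤ n v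
sumℤ-mono-≤ zero    le = ℤP.≤-refl
sumℤ-mono-≤ (suc n) le = ℤP.+-mono-≤ (le zero) (sumℤ-mono-≤ n (le ∘ suc))

sumℤ-mono-< : ∀ n {u v : Fin n → ℤ} → (∀ i → u i ℤ.≤ v i) → ∀ k → u k ℤ.< v k →
  sumℤ n u ℤ.< sumℤ n v
sumℤ-mono-< (suc n) le zero    lt = ℤP.+-mono-<-≤ lt (sumℤ-mono-≤ n (le ∘ suc))
sumℤ-mono-< (suc n) le (suc k) lt = ℤP.+-mono-≤-< (le zero) (sumℤ-mono-< n (le ∘ suc) k lt)

toℚ-sumℤ : ∀ n (u : Fin n → ℤ) → toℚ (sumℤ n u) ≡ sumℚ n (toℚ ∘ u)
toℚ-sumℤ zero    u = refl
toℚ-sumℤ (suc n) u = trans (toℚ-+ (u zero) _) (cong (toℚ (u zero) ℚ.+_) (toℚ-sumℤ n (u ∘ suc)))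

mulℚ-cong : ∀ {n} (A : Mat ℚ n) {u v : Vec ℚ n} → (∀ j → u j ≡ v j) → ∀ i → mulℚ A u i ≡ mulℚ A v i
mulℚ-cong {n} A eq i = sumℚ-cong n (λ j → cong (A i j ℚ.*_) (eq j))

mulℚ-+ : ∀ {n} (A : Mat ℚ n) (u v : Vec ℚ n) →
  ∀ i → mulℚ A (λ j → u j ℚ.+ v j) i ≡ mulℚ A u i ℚ.+ mulℚ A v i
mulℚ-+ {n} A u v i = trans (sumℚ-cong n (λ j → ℚP.*-distribˡ-+ (A i j) (u j) (v j))) (sumℚ-+ n _ _)

mulℚ-mulℚ : ∀ {n} (A B : Mat ℚ n) (v : Vec ℚ n) →
  ∀ i → mulℚ A (mulℚ B v) i ≡ sumℚ n (λ k → sumℚ n (λ j → A i j ℚ.* B j k) ℚ.* v k)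
mulℚ-mulℚ {n} A B v i = begin
  sumℚ n (λ j → A i j ℚ.* sumℚ n (λ k → B j k ℚ.* v k))
    ≡⟨ sumℚ-cong n (λ j → sym (sumℚ-*ˡ n (A i j) _)) ⟩
  sumℚ n (λ j → sumℚ n (λ k → A i j ℚ.* (B j k ℚ.* v k)))
    ≡⟨ sumℚ-cong n (λ j → sumℚ-cong n (λ k → sym (ℚP.*-assoc (A i j) (B j k) (v k)))) ⟩
  sumℚ n (λ j → sumℚ n (λ k → A i j ℚ.* B j k ℚ.* v k))
    ≡⟨ sumℚ-comm n n _ ⟩
  sumℚ n (λ k → sumℚ n (λ j → A i j ℚ.* B j k ℚ.* v k))
    ≡⟨ sumℚ-cong n (λ k → sumℚ-*ʳ n (v k) _) ⟩
  sumℚ n (λ k → sumℚ n (λ j → A i j ℚ.* B j k) ℚ.* v k) ∎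
  where open ≡-Reasoning

mulℚ-identity : ∀ {n} (v : Vec ℚ n) → ∀ i → mulℚ δ v i ≡ v i
mulℚ-identity {suc n} v zero = begin
  1ℚ ℚ.* v zero ℚ.+ sumℚ n (λ k → 0ℚ ℚ.* v (suc k))
    ≡⟨ cong₂ ℚ._+_ (ℚP.*-identityˡ (v zero)) (trans (sumℚ-cong n (ℚP.*-zeroˡ ∘ v ∘ suc)) (sumℚ-0 n)) ⟩
  v zero ℚ.+ 0ℚ
    ≡⟨ ℚP.+-identityʳ (v zero) ⟩
  v zero ∎
  where open ≡-Reasoning
mulℚ-identity {suc n} v (suc i) = begin
  0ℚ ℚ.* v zero ℚ.+ mulℚ δ (v ∘ suc) i ≡⟨ cong₂ ℚ._+_ (ℚP.*-zeroˡ (v zero)) (mulℚ-identity (v ∘ suc) i) ⟩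
  0ℚ ℚ.+ v (suc i)                     ≡⟨ ℚP.+-identityˡ (v (suc i)) ⟩
  v (suc i)                            ∎
  where open ≡-Reasoning

mulℚ-nonneg : ∀ {n} (A : Mat ℚ n) (v : Vec ℚ n) → NonnegMat A → (∀ j → 0ℚ ℚ.≤ v j) →
  ∀ i → 0ℚ ℚ.≤ mulℚ A v i
mulℚ-nonneg {n} A v A≥0 v≥0 i = subst (ℚ._≤ mulℚ A v i) (sumℚ-0 n)
  (sumℚ-mono-≤ n (λ j → ℚP.nonNegative⁻¹ _ {{ℚP.nonNeg*nonNeg⇒nonNeg (A i j) {{ℚ.nonNegative (A≥0 i j)}}
                                                                 (v j) {{ℚ.nonNegative (v≥0 j)}}}}))

toℚ-mulℤ : ∀ {n} (L : Mat ℤ n) (z : Vec ℤ n) →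
  ∀ i → toℚ (mulℤ L z i) ≡ mulℚ (λ j k → toℚ (L j k)) (toℚ ∘ z) i
toℚ-mulℤ {n} L z i = trans (toℚ-sumℤ n _) (sumℚ-cong n (λ j → toℚ-* (L i j) (z j)))

potential : ∀ {n} → Mat ℚ n → Vec ℤ n → Vec ℚ n
potential A g = mulℚ A (toℚ ∘ g)

potential-shift : ∀ {n} (L : Mat ℤ n) (Linv : Mat ℚ n) →
  (∀ i k → sumℚ n (λ j → Linv i j ℚ.* toℚ (L j k)) ≡ δ i k) →
  (g z : Vec ℤ n) → ∀ i → potential Linv (λ j → g j ℤ.+ mulℤ L z j) i ≡ potential Linv g i ℚ.+ toℚ (z i)
potential-shift {n} L Linv LinvL≡I g z i = begin
  mulℚ Linv (λ j → toℚ (g j ℤ.+ mulℤ L z j)) i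
    ≡⟨ mulℚ-cong Linv (λ j → trans (toℚ-+ (g j) _) (cong (toℚ (g j) ℚ.+_) (toℚ-mulℤ L z j))) i ⟩
  mulℚ Linv (λ j → toℚ (g j) ℚ.+ mulℚ Lℚ (toℚ ∘ z) j) i
    ≡⟨ mulℚ-+ Linv (toℚ ∘ g) _ i ⟩
  potential Linv g i ℚ.+ mulℚ Linv (mulℚ Lℚ (toℚ ∘ z)) i
    ≡⟨ cong (potential Linv g i ℚ.+_) (mulℚ-mulℚ Linv Lℚ (toℚ ∘ z) i) ⟩
  potential Linv g i ℚ.+ sumℚ n (λ k → sumℚ n (λ j → Linv i j ℚ.* Lℚ j k) ℚ.* toℚ (z k))
    ≡⟨ cong (potential Linv g i ℚ.+_) (sumℚ-cong n (λ k → cong (ℚ._* toℚ (z k)) (LinvL≡I i k))) ⟩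
  potential Linv g i ℚ.+ mulℚ δ (toℚ ∘ z) i
    ≡⟨ cong (potential Linv g i ℚ.+_) (mulℚ-identity (toℚ ∘ z) i) ⟩
  potential Linv g i ℚ.+ toℚ (z i) ∎
  where
  open ≡-Reasoning
  Lℚ : Mat ℚ n
  Lℚ j k = toℚ (L j k)

potential-nonneg : ∀ {n} (A : Mat ℚ n) (g : Vec ℤ n) → NonnegMat A → Nonneg g →
  ∀ i → 0ℚ ℚ.≤ potential A g i
potential-nonneg A g A≥0 g≥0 = mulℚ-nonneg A (toℚ ∘ g) A≥0 (toℚ-mono-≤ ∘ g≥0)

square-mono-≤ : ∀ {a b} → 0ℚ ℚ.≤ a → a ℚ.≤ b → a ℚ.* a ℚ.≤ b ℚ.* b
square-mono-≤ {a} {b} 0≤a a≤b = ℚP.≤-trans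
  (ℚP.*-monoˡ-≤-nonNeg a {{ℚ.nonNegative 0≤a}} a≤b)
  (ℚP.*-monoʳ-≤-nonNeg b {{ℚ.nonNegative (ℚP.≤-trans 0≤a a≤b)}} a≤b)

square-mono-< : ∀ {a b} → 0ℚ ℚ.≤ a → a ℚ.< b → a ℚ.* a ℚ.< b ℚ.* b
square-mono-< {a} {b} 0≤a a<b = ℚP.≤-<-trans
  (ℚP.*-monoˡ-≤-nonNeg a {{ℚ.nonNegative 0≤a}} (ℚP.<⇒≤ a<b))
  (ℚP.*-monoˡ-<-pos b {{ℚ.positive (ℚP.≤-<-trans 0≤a a<b)}} a<b)

mulℤ-cong : ∀ {n} (L : Mat ℤ n) {y z : Vec ℤ n} → (∀ j → y j ≡ z j) → ∀ i → mulℤ L y i ≡ mulℤ L z i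
mulℤ-cong {n} L eq i = sumℤ-cong n (λ j → cong (L i j ℤ.*_) (eq j))

mulℤ-zeroʳ : ∀ {n} (L : Mat ℤ n) → ∀ i → mulℤ L (λ _ → + 0) i ≡ + 0
mulℤ-zeroʳ {n} L i = trans (sumℤ-cong n (ℤP.*-zeroʳ ∘ L i)) (sumℤ-0 n)

Z-matrix-row-antitone : ∀ {n} (L : Mat ℤ n) → IsZMatrix L → {y z : Vec ℤ n} →
  (∀ j → z j ℤ.≤ y j) → ∀ i → z i ≡ y i → mulℤ L y i ℤ.≤ mulℤ L z i
Z-matrix-row-antitone {n} L isZ {y} {z} z≤y i zi≡yi = sumℤ-mono-≤ n term
  where
  term : ∀ j → L i j ℤ.* y j ℤ.≤ L i j ℤ.* z j
  term j with i FP.≟ j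
  ... | yes refl = ℤP.≤-reflexive (cong (L i i ℤ.*_) (sym zi≡yi))
  ... | no  i≢j  = ℤP.*-monoˡ-≤-nonPos (L i j) {{ℤ.nonPositive (isZ i j i≢j)}} (z≤y j)

module LeastAction {n} (L : Mat ℤ n) (isZ : IsZMatrix L) (b : Vec ℤ n) where

  config : Vec ℤ n → Vec ℤ n
  config z i = b i ℤ.+ mulℤ L z i

  Feasible : Vec ℤ n → Set
  Feasible z = Nonneg (config z)

  BelowFeasible : Vec ℤ n → Set
  BelowFeasible z = ∀ y → Feasible y → ∀ i → z i ℤ.≤ y i

  raise : Fin n → Vec ℤ n → Vec ℤ n
  raise i z = updateAt z i ℤ.suc

  raise-≥ : ∀ i z j → z j ℤ.≤ raise i z j
  raise-≥ i z j with i FP.≟ j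
  ... | yes refl = ℤP.≤-trans (ℤP.i≤suc[i] (z i)) (ℤP.≤-reflexive (sym (updateAt-updates i z)))
  ... | no  i≢j  = ℤP.≤-reflexive (sym (updateAt-minimal j i z (i≢j ∘ sym)))

  raise-> : ∀ i z → z i ℤ.< raise i z i
  raise-> i z = ℤP.suc[i]≤j⇒i<j (ℤP.≤-reflexive (sym (updateAt-updates i z)))

  -- A violated row i forces every feasible y ≥ z to exceed z at i: were y i ≡ z i,
  -- row i of config y would be at most that of config z.
  raise-below : ∀ {i z} → BelowFeasible z → config z i ℤ.< + 0 → BelowFeasible (raise i z)
  raise-below {i} {z} below violated y feasible j with i FP.≟ j
  ... | yes refl = ℤP.≤-trans (ℤP.≤-reflexive (updateAt-updates i z)) (ℤP.i<j⇒suc[i]≤j zi<yi)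
    where
    zi<yi : z i ℤ.< y i
    zi<yi = ℤP.≤∧≢⇒< (below y feasible i) λ zi≡yi → ℤP.<-irrefl refl (ℤP.≤-<-trans
      (ℤP.≤-trans (feasible i)
        (ℤP.+-monoʳ-≤ (b i) (Z-matrix-row-antitone L isZ (below y feasible) i zi≡yi)))
      violated)
  ... | no  i≢j  = ℤP.≤-trans (ℤP.≤-reflexive (updateAt-minimal j i z (i≢j ∘ sym))) (below y feasible j)

  gap : Vec ℤ n → Vec ℤ n → ℤ
  gap c z = sumℤ n (λ i → c i ℤ.- z i)

  gap-nonneg : ∀ {c z} → (∀ i → z i ℤ.≤ c i) → + 0 ℤ.≤ gap c z
  gap-nonneg {c} {z} z≤c = subst (ℤ._≤ gap c z) (sumℤ-0 n) (sumℤ-mono-≤ n (ℤP.i≤j⇒0≤j-i ∘ z≤c))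

  gap-raise : ∀ c i z → gap c (raise i z) ℤ.< gap c z
  gap-raise c i z = sumℤ-mono-< n (λ j → ℤP.+-monoʳ-≤ (c j) (ℤP.neg-mono-≤ (raise-≥ i z j))) i
    (ℤP.+-monoʳ-< (c i) (ℤP.neg-mono-< (raise-> i z)))

  least-feasible : ∀ lo → BelowFeasible lo → ∀ c → Feasible c → ∃ λ z → Feasible z × BelowFeasible z
  least-feasible lo lo-below c c-feasible = climb (suc ℤ.∣ gap c lo ∣) lo lo-below
    (subst (ℤ._< + suc ℤ.∣ gap c lo ∣) (ℤP.0≤i⇒+∣i∣≡i (gap-nonneg (lo-below c c-feasible)))
           (ℤ.+<+ (ℕP.n<1+n _)))
    where
    climb : ∀ k z → BelowFeasible z → gap c z ℤ.< + k → ∃ λ z → Feasible z × BelowFeasible z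
    climb zero    z below bound =
      ⊥-elim (ℤP.<-irrefl refl (ℤP.≤-<-trans (gap-nonneg (below c c-feasible)) bound))
    climb (suc k) z below bound with FP.all? (λ i → + 0 ℤ.≤? config z i)
    ... | yes feasible = z , feasible , below
    ... | no  infeasible with FP.¬∀⟶∃¬ n _ (λ i → + 0 ℤ.≤? config z i) infeasible
    ... | i , violated = climb k (raise i z) (raise-below below (ℤP.≰⇒> violated))
      (ℤP.<-≤-trans (gap-raise c i z) (ℤP.i<j⇒i≤pred[j] bound))

module EnergyMinimizer {n} (L : Mat ℤ n) (Linv : Mat ℚ n) (isZ : IsZMatrix L)
  (LinvL≡I : ∀ i k → sumℚ n (λ j → Linv i j ℚ.* toℚ (L j k)) ≡ δ i k)
  (Linv≥0 : NonnegMat Linv) (f : Vec ℤ n) where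

  open LeastAction L isZ f public

  config-equiv : ∀ z → Equiv L f (config z)
  config-equiv z = z , λ i → [a+x]-a≡x (f i) (mulℤ L z i)
    where
    [a+x]-a≡x : ∀ a x → (a ℤ.+ x) ℤ.- a ≡ x
    [a+x]-a≡x = solve-∀

  equiv⇒config : ∀ h (e : Equiv L f h) → ∀ i → h i ≡ config (proj₁ e) i
  equiv⇒config h (z , h-f≡Lz) i = trans (sym (a+[b-a]≡b (f i) (h i))) (cong (ℤ._+_ (f i)) (h-f≡Lz i))
    where
    a+[b-a]≡b : ∀ a b → a ℤ.+ (b ℤ.- a) ≡ b
    a+[b-a]≡b = solve-∀

  equiv⇒feasible : ∀ h (e : Equiv L f h) → Nonneg h → Feasible (proj₁ e)
  equiv⇒feasible h e h≥0 i = subst (+ 0 ℤ.≤_) (equiv⇒config h e i) (h≥0 i)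

  potential-equiv : ∀ h (e : Equiv L f h) →
    ∀ i → potential Linv h i ≡ potential Linv f i ℚ.+ toℚ (proj₁ e i)
  potential-equiv h e i = trans (mulℚ-cong Linv (cong toℚ ∘ equiv⇒config h e) i)
                              (potential-shift L Linv LinvL≡I f (proj₁ e) i)

  zero-feasible : Nonneg f → Feasible (λ _ → + 0)
  zero-feasible f≥0 i = subst (+ 0 ℤ.≤_) config0≡f (f≥0 i)
    where
    config0≡f : f i ≡ config (λ _ → + 0) i
    config0≡f = sym (trans (cong (ℤ._+_ (f i)) (mulℤ-zeroʳ L i)) (ℤP.+-identityʳ (f i)))

  -- Applying the non-negative L⁻¹ to a feasible configuration f + L y gives L⁻¹ f + y ≥ 0.
  feasible-bounded-below : ∃ BelowFeasible
  feasible-bounded-below = lo , lo-below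
    where
    bound : ∀ i → ∃ λ a → potential Linv f i ℚ.≤ toℚ a
    bound i = integer-above (potential Linv f i)
    lo : Vec ℤ n
    lo i = ℤ.- proj₁ (bound i)
    -a≤y : ∀ a y → + 0 ℤ.≤ a ℤ.+ y → ℤ.- a ℤ.≤ y
    -a≤y a y 0≤a+y = subst₂ ℤ._≤_ (ℤP.+-identityʳ (ℤ.- a)) (-a+[a+y]≡y a y) (ℤP.+-monoʳ-≤ (ℤ.- a) 0≤a+y)
      where
      -a+[a+y]≡y : ∀ a y → ℤ.- a ℤ.+ (a ℤ.+ y) ≡ y
      -a+[a+y]≡y = solve-∀
    lo-below : BelowFeasible lo
    lo-below y feasible i = -a≤y a (y i) (toℚ-cancel-≤ (begin
      0ℚ                                 ≤⟨ potential-nonneg Linv (config y) Linv≥0 feasible i ⟩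
      potential Linv (config y) i        ≡⟨ potential-equiv (config y) (config-equiv y) i ⟩
      potential Linv f i ℚ.+ toℚ (y i)   ≤⟨ ℚP.+-monoˡ-≤ (toℚ (y i)) (proj₂ (bound i)) ⟩
      toℚ a ℚ.+ toℚ (y i)                ≡⟨ toℚ-+ a (y i) ⟨
      toℚ (a ℤ.+ y i)                    ∎))
      where
      open ℚP.≤-Reasoning
      a : ℤ
      a = proj₁ (bound i)

  potential-mono : ∀ {z} h (e : Equiv L f h) → (∀ i → z i ℤ.≤ proj₁ e i) →
    ∀ i → potential Linv (config z) i ℚ.≤ potential Linv h i
  potential-mono {z} h e z≤ i = subst₂ ℚ._≤_
    (sym (potential-equiv (config z) (config-equiv z) i)) (sym (potential-equiv h e i))
    (ℚP.+-monoʳ-≤ (potential Linv f i) (toℚ-mono-≤ (z≤ i)))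

  potential-mono-< : ∀ {z} h (e : Equiv L f h) → ∀ i → z i ℤ.< proj₁ e i →
    potential Linv (config z) i ℚ.< potential Linv h i
  potential-mono-< {z} h e i z<  = subst₂ ℚ._<_
    (sym (potential-equiv (config z) (config-equiv z) i)) (sym (potential-equiv h e i))
    (ℚP.+-monoʳ-< (potential Linv f i) (toℚ-mono-< z<))

  energy-mono-≤ : ∀ {z} → Feasible z → ∀ h (e : Equiv L f h) → (∀ i → z i ℤ.≤ proj₁ e i) →
    energy Linv (config z) ℚ.≤ energy Linv h
  energy-mono-≤ {z} feasible h e z≤ = sumℚ-mono-≤ n (λ i →
    square-mono-≤ (potential-nonneg Linv (config z) Linv≥0 feasible i) (potential-mono h e z≤ i))

  energy-mono-< : ∀ {z} → Feasible z → ∀ h (e : Equiv L f h) → (∀ i → z i ℤ.≤ proj₁ e i) →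
    ∀ k → z k ℤ.< proj₁ e k → energy Linv (config z) ℚ.< energy Linv h
  energy-mono-< {z} feasible h e z≤ k z< = sumℚ-mono-< n (λ i →
    square-mono-≤ (potential-nonneg Linv (config z) Linv≥0 feasible i) (potential-mono h e z≤ i)) k
    (square-mono-< (potential-nonneg Linv (config z) Linv≥0 feasible k) (potential-mono-< h e k z<))

theorem3p4 : (n : ℕ) (L : Mat ℤ n) (Linv : Mat ℚ n) →
    IsMMatrixWithInverse L Linv →
    (f : Vec ℤ n) → Nonneg f →
    ∃ λ (g : Vec ℤ n) → IsEnergyMinimizer L Linv f g ×
    (∀ h → IsEnergyMinimizer L Linv f h → ∀ i → h i ≡ g i)
theorem3p4 n L Linv (isZ , (_ , LinvL≡I) , Linv≥0) f f≥0 =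
  config z , (config-equiv z , z-feasible , minimal) , unique
  where
  open EnergyMinimizer L Linv isZ LinvL≡I Linv≥0 f

  least : ∃ λ z → Feasible z × BelowFeasible z
  least = least-feasible (proj₁ feasible-bounded-below) (proj₂ feasible-bounded-below)
                         (λ _ → + 0) (zero-feasible f≥0)

  z : Vec ℤ n
  z = proj₁ least

  z-feasible : Feasible z
  z-feasible = proj₁ (proj₂ least)

  z-below : BelowFeasible z
  z-below = proj₂ (proj₂ least)

  minimal : ∀ h → Equiv L f h → Nonneg h → energy Linv (config z) ℚ.≤ energy Linv h
  minimal h e h≥0 = energy-mono-≤ z-feasible h e (z-below _ (equiv⇒feasible h e h≥0))

  unique : ∀ h → IsEnergyMinimizer L Linv f h → ∀ i → h i ≡ config z i
  unique h (e , h≥0 , h-minimal) i = trans (equiv⇒config h e i) (cong (ℤ._+_ (f i)) (mulℤ-cong L zₕ≡z i))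
    where
    z≤zₕ : ∀ k → z k ℤ.≤ proj₁ e k
    z≤zₕ = z-below _ (equiv⇒feasible h e h≥0)
    zₕ≡z : ∀ k → proj₁ e k ≡ z k
    zₕ≡z k = ℤP.≤-antisym (ℤP.≮⇒≥ λ z<zₕ → ℚP.<-irrefl refl (ℚP.<-≤-trans
      (energy-mono-< z-feasible h e z≤zₕ k z<zₕ) (h-minimal (config z) (config-equiv z) z-feasible)))
      (z≤zₕ k)
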